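{- If $T$ is a subcubic tree of order $n$, then $\gamma_{e,f}^*(T)=\frac{n+2}{6}$.
   Context: All graphs are finite, simple and undirected. A graph is subcubic if all vertex degrees are at most $3$. For a graph $G$, $\mathrm{dist}_G(u,v)$ denotes the usual distance ($\infty$ if there is no path). The fractional porous exponential domination number $\gamma_{e,f}^*(G)$ is the optimum value of the linear program: minimize $\sum_{u\in V(G)}x(u)$ subject to $\sum_{u\in V(G)}\left(\tfrac12\right)^{\mathrm{dist}_G(u,v)-1}x(u)\geq 1$ for every $v\in V(G)$ and $x(u)\geq 0$ for every $u\in V(G)$ (with $(1/2)^\infty=0$). -}

module Defs where

open import Data.Nat as ℕ using (ℕ; zero; suc)
open import Data.Fin using (Fin; zero; suc; _≟_)
open import Data.Bool using (Bool; true; false; _∧_; _∨_; if_then_else_)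
open import Data.Maybe using (Maybe; just; nothing)
open import Data.Integer using (+_)
open import Data.Rational using (ℚ; 0ℚ; _+_; _*_; ½; _/_)
open import Data.Product using (Σ; ∃; _×_)
open import Function.Definitions using (Injective)
open import Relation.Binary.PropositionalEquality using (_≡_)
open import Relation.Nullary.Decidable using (⌊_⌋)

record Graph (n : ℕ) : Set where
  field
    adj   : Fin n → Fin n → Bool
    sym   : ∀ u v → adj u v ≡ adj v u
    irrefl : ∀ v → adj v v ≡ false
open Graph public

sumℕ : ∀ {n} → (Fin n → ℕ) → ℕ
sumℕ {zero} f = 0
sumℕ {suc n} f = f zero ℕ.+ sumℕ (λ i → f (suc i))

sumℚ : ∀ {n} → (Fin n → ℚ) → ℚ
sumℚ {zero} f = 0ℚ
sumℚ {suc n} f = f zero + sumℚ (λ i → f (suc i))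

anyF : ∀ {n} → (Fin n → Bool) → Bool
anyF {zero} f = false
anyF {suc n} f = f zero ∨ anyF (λ i → f (suc i))

b2n : Bool → ℕ
b2n true = 1
b2n false = 0

degree : ∀ {n} → Graph n → Fin n → ℕ
degree G v = sumℕ (λ w → b2n (adj G v w))

Subcubic : ∀ {n} → Graph n → Set
Subcubic G = ∀ v → degree G v ℕ.≤ 3

reach : ∀ {n} → Graph n → ℕ → Fin n → Fin n → Bool
reach G zero u v = ⌊ u ≟ v ⌋
reach G (suc k) u v = anyF (λ w → adj G u w ∧ reach G k w v)

firstReach : ∀ {n} → Graph n → Fin n → Fin n → ℕ → ℕ → Maybe ℕ
firstReach G u v start zero = nothing
firstReach G u v start (suc b) =
  if reach G start u v then just start else firstReach G u v (suc start) b

-- graph distance; nothing encodes ∞ (shortest paths have length < n)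
dist : ∀ {n} → Graph n → Fin n → Fin n → Maybe ℕ
dist {n} G u v = firstReach G u v 0 n

Connected : ∀ {n} → Graph n → Set
Connected {n} G = ∀ u v → ∃ λ k → reach G k u v ≡ true

-- a cycle of length k+3: injective sequence of vertices, consecutive ones
-- (cyclically) adjacent
next : ∀ {m} → Fin (suc m) → Fin (suc m)
next {zero} zero = zero
next {suc m} zero = suc zero
next {suc m} (suc i) with next {m} i
... | zero = zero
... | suc j = suc (suc j)

record Cycle {n} (G : Graph n) : Set where
  field
    len  : ℕ
    vert : Fin (3 ℕ.+ len) → Fin n
    inj  : Injective _≡_ _≡_ vert
    edge : ∀ i → adj G (vert i) (vert (next i)) ≡ true

Acyclic : ∀ {n} → Graph n → Set
Acyclic G = Cycle G → Data.Empty.⊥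
  where import Data.Empty

IsTree : ∀ {n} → Graph n → Set
IsTree {n} G = (0 ℕ.< n) × Connected G × Acyclic G

half^ : ℕ → ℚ
half^ zero = + 1 / 1
half^ (suc k) = ½ * half^ k

-- (1/2)^(d-1) with (1/2)^∞ = 0; note (1/2)^(0-1) = 2
weight : Maybe ℕ → ℚ
weight nothing = 0ℚ
weight (just d) = (+ 2 / 1) * half^ d

Feasible : ∀ {n} → Graph n → (Fin n → ℚ) → Set
Feasible G x =
  (∀ u → 0ℚ Data.Rational.≤ x u) ×
  (∀ v → Data.Rational.1ℚ Data.Rational.≤ sumℚ (λ u → weight (dist G u v) * x u))
  where import Data.Rational

LPOptimum : ∀ {n} → Graph n → ℚ → Set
LPOptimum G r =
  (Σ _ λ x → Feasible G x × sumℚ x ≡ r) ×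
  (∀ x → Feasible G x → r Data.Rational.≤ sumℚ x)
  where import Data.Rational

module Submission where

-- Take x(u) = (3 − deg u)/6.  Rooting T at a vertex t, every other vertex has
-- exactly one neighbour one step closer to t, its parent.  With
-- h(u) = (1/2)^dist(u,t), an edge from a child w to its parent contributes
-- h(w) + 2h(w) to Σ_u h(u) deg(u), so that sum is 3(Σ_u h(u) − 1) and hence
-- Σ_u h(u)(3 − deg u) = 3: the constraint at t holds with equality.  The same
-- count with h = 1 gives Σ_u (3 − deg u) = n + 2.  Since distances are
-- symmetric, x is also a dual solution of the same value, so weak duality
-- shows that x is optimal.

open import Defs
open import Data.Nat using (ℕ; zero; suc; _≤_; _<_; z≤n; s≤s⁻¹)
open import Data.Integer using (+_)
open import Data.Rational using (_/_)

open import Algebra.Bundles using (CommutativeSemiring; CommutativeRing)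
open import Data.Bool using (Bool; true; false; _∧_; _∨_)
open import Data.Bool.Properties using (∧-conicalˡ; ∧-conicalʳ; ∨-zeroʳ; T-≡; ⇔→≡; ¬-not)
open import Data.Fin using (Fin; zero; suc; inject₁; fromℕ; toℕ; _≟_)
import Data.Fin.Properties as Fin
open import Data.Fin.Relation.Unary.Top using (view; ‵fromℕ; ‵inj₁)
open import Data.Integer as ℤ using (ℤ)
import Data.Integer.Properties as ℤₚ
open import Data.Integer.Tactic.RingSolver using (solve-∀)
open import Data.List using (List; []; _∷_; _∷ʳ_; length; lookup)
open import Data.List.Membership.Propositional.Properties using (∈-lookup)
open import Data.List.Relation.Unary.All as All using (All; []; _∷_)
import Data.List.Relation.Unary.All.Properties as Allₚ
open import Data.List.Relation.Unary.AllPairs using ([]; _∷_)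
import Data.List.Relation.Unary.AllPairs.Properties as AllPairsₚ
open import Data.List.Relation.Unary.Unique.Propositional using (Unique)
open import Data.Maybe using (just)
import Data.Nat as ℕ
import Data.Nat.Properties as ℕₚ
open import Data.Product using (∃; _×_; _,_; proj₁; proj₂)
open import Data.Rational as ℚ using (ℚ; 0ℚ; 1ℚ; ½)
import Data.Rational.Properties as ℚₚ
open import Data.Rational.Solver using (module +-*-Solver)
open import Data.Rational.Unnormalised as ℚᵘ using (mkℚᵘ; *≡*)
import Data.Rational.Unnormalised.Properties as ℚᵘₚ
open import Data.Sum using (_⊎_; inj₁; inj₂; [_,_])
open import Function using (_∘_; Equivalence; mk⇔)
open import Relation.Binary using (tri<; tri≈; tri>)
open import Relation.Binary.PropositionalEquality
  using (_≡_; _≢_; ≢-sym; refl; trans; cong; cong₂; subst; subst₂; module ≡-Reasoning)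
  renaming (sym to ≡-sym)
open import Relation.Nullary using (Dec; ¬_; yes; no; contradiction)
open import Relation.Nullary.Decidable using (⌊_⌋; toWitness; isYes≗does; dec-true; dec-false)

open import Algebra.Properties.Group ℚₚ.+-0-group using (∙-cancelʳ)

⌊⌋-true⁺ : ∀ {a} {A : Set a} (a? : Dec A) → A → ⌊ a? ⌋ ≡ true
⌊⌋-true⁺ a? a = trans (isYes≗does a?) (dec-true a? a)

⌊⌋-true⁻ : ∀ {a} {A : Set a} (a? : Dec A) → ⌊ a? ⌋ ≡ true → A
⌊⌋-true⁻ a? e = toWitness (Equivalence.from T-≡ e)

⌊⌋-false⁺ : ∀ {a} {A : Set a} (a? : Dec A) → ¬ A → ⌊ a? ⌋ ≡ false
⌊⌋-false⁺ a? ¬a = trans (isYes≗does a?) (dec-false a? ¬a)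

sumℕ-b2n-none : ∀ {n} (d : Fin n → Bool) → (∀ i → d i ≡ false) → sumℕ (b2n ∘ d) ≡ 0
sumℕ-b2n-none {zero}  d none = refl
sumℕ-b2n-none {suc n} d none rewrite none zero = sumℕ-b2n-none (d ∘ suc) (none ∘ suc)

sumℕ-b2n-unique : ∀ {n} (d : Fin n → Bool) i → d i ≡ true → (∀ j → d j ≡ true → j ≡ i) →
                  sumℕ (b2n ∘ d) ≡ 1
sumℕ-b2n-unique d zero di only rewrite di =
  cong suc (sumℕ-b2n-none (d ∘ suc) λ j → ¬-not λ dj → contradiction (only (suc j) dj) λ ())
sumℕ-b2n-unique d (suc i) di only rewrite ¬-not {d zero} (λ d0 → contradiction (only zero d0) λ ()) =
  sumℕ-b2n-unique (d ∘ suc) i di λ j dj → Fin.suc-injective (only (suc j) dj)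

n≢2+n : ∀ n → n ≢ suc (suc n)
n≢2+n n e = ℕₚ.<-irrefl e (ℕₚ.m<n⇒m<1+n (ℕₚ.n<1+n n))

b2n-step-apart : ∀ {a b} → a ≡ suc b ⊎ b ≡ suc a →
                 b2n ⌊ a ℕ.≟ suc b ⌋ ℕ.+ b2n ⌊ b ℕ.≟ suc a ⌋ ≡ 1
b2n-step-apart {b = b} (inj₁ refl) rewrite ⌊⌋-true⁺ (suc b ℕ.≟ suc b) refl
                                         | ⌊⌋-false⁺ (b ℕ.≟ suc (suc b)) (n≢2+n b) = refl
b2n-step-apart {a = a} (inj₂ refl) rewrite ⌊⌋-false⁺ (a ℕ.≟ suc (suc a)) (n≢2+n a)
                                         | ⌊⌋-true⁺ (suc a ℕ.≟ suc a) refl = refl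

⌊suc≟suc⌋ : ∀ {n} (u i : Fin n) → ⌊ suc u ≟ suc i ⌋ ≡ ⌊ u ≟ i ⌋
⌊suc≟suc⌋ u i = ⇔→≡ {z = true} (mk⇔
  (λ e → ⌊⌋-true⁺ (u ≟ i) (Fin.suc-injective (⌊⌋-true⁻ (suc u ≟ suc i) e)))
  (λ e → ⌊⌋-true⁺ (suc u ≟ suc i) (cong suc (⌊⌋-true⁻ (u ≟ i) e))))

b2n-split : ∀ x p q → (x ≡ true → b2n p ℕ.+ b2n q ≡ 1) → b2n x ≡ b2n (x ∧ p) ℕ.+ b2n (x ∧ q)
b2n-split false p q _ = refl
b2n-split true  p q h = ≡-sym (h refl)

anyF-true⁻ : ∀ {n} (f : Fin n → Bool) → anyF f ≡ true → ∃ λ w → f w ≡ true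
anyF-true⁻ {suc n} f eq with f zero in f₀
... | true  = zero , f₀
... | false = let w , fw = anyF-true⁻ (f ∘ suc) eq in suc w , fw

anyF-true⁺ : ∀ {n} (f : Fin n → Bool) w → f w ≡ true → anyF f ≡ true
anyF-true⁺ f zero    fw rewrite fw = refl
anyF-true⁺ f (suc w) fw = trans (cong (f zero ∨_) (anyF-true⁺ (f ∘ suc) w fw)) (∨-zeroʳ (f zero))

Least : (ℕ → Bool) → ℕ → Set
Least P m = P m ≡ true × (∀ j → j < m → P j ≡ false)

least-or-none : (P : ℕ → Bool) → ∀ b → ∃ (Least P) ⊎ (∀ j → j < b → P j ≡ false)
least-or-none P zero = inj₂ λ _ ()
least-or-none P (suc b) with least-or-none P b
... | inj₁ found = inj₁ found
... | inj₂ none with P b in Pb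
...   | true  = inj₁ (b , Pb , none)
...   | false = inj₂ λ j j<1+b → [ none j , (λ { refl → Pb }) ] (ℕₚ.m<1+n⇒m<n∨m≡n j<1+b)

least : (P : ℕ → Bool) → ∀ k → P k ≡ true → ∃ (Least P)
least P k Pk with least-or-none P (suc k)
... | inj₁ found = found
... | inj₂ none  = contradiction (trans (≡-sym Pk) (none k ℕₚ.≤-refl)) λ ()

lookup-injective : ∀ {A : Set} {xs : List A} → Unique xs →
                   ∀ i j → lookup xs i ≡ lookup xs j → i ≡ j
lookup-injective (_ ∷ _)     zero    zero    _ = refl
lookup-injective (x∉ ∷ _)    zero    (suc j) e = contradiction e (All.lookup x∉ (∈-lookup j))
lookup-injective (x∉ ∷ _)    (suc i) zero    e = contradiction (≡-sym e) (All.lookup x∉ (∈-lookup i))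
lookup-injective (_ ∷ uniq) (suc i) (suc j) e = cong suc (lookup-injective uniq i j e)

next-inject₁ : ∀ {m} (i : Fin m) → next (inject₁ i) ≡ suc i
next-inject₁ {suc m} zero    = refl
next-inject₁ {suc m} (suc i) rewrite next-inject₁ i = refl

next-fromℕ : ∀ m → next (fromℕ m) ≡ zero
next-fromℕ zero    = refl
next-fromℕ (suc m) rewrite next-fromℕ m = refl

module Walk {n} (G : Graph n) where

  Adj : Fin n → Fin n → Set
  Adj u v = adj G u v ≡ true

  Reach : ℕ → Fin n → Fin n → Set
  Reach k u v = reach G k u v ≡ true

  adj-sym : ∀ {u v} → Adj u v → Adj v u
  adj-sym {u} {v} a = trans (sym G v u) a

  adj-irrefl : ∀ {u v} → Adj u v → u ≢ v
  adj-irrefl {u} a refl with trans (≡-sym a) (irrefl G u)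
  ... | ()

  reach-zero⁻ : ∀ {u v} → Reach 0 u v → u ≡ v
  reach-zero⁻ {u} {v} = ⌊⌋-true⁻ (u ≟ v)

  reach-refl : ∀ u → Reach 0 u u
  reach-refl u = ⌊⌋-true⁺ (u ≟ u) refl

  reach-∷ : ∀ k {u} w {v} → Adj u w → Reach k w v → Reach (suc k) u v
  reach-∷ k {u} w {v} a r = anyF-true⁺ (λ y → adj G u y ∧ reach G k y v) w (cong₂ _∧_ a r)

  reach-∷⁻ : ∀ k {u v} → Reach (suc k) u v → ∃ λ w → Adj u w × Reach k w v
  reach-∷⁻ k {u} {v} r =
    let w , e = anyF-true⁻ (λ y → adj G u y ∧ reach G k y v) r
    in w , ∧-conicalˡ _ _ e , ∧-conicalʳ _ _ e

  reach-∷ʳ : ∀ k {u} w {v} → Reach k u w → Adj w v → Reach (suc k) u v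
  reach-∷ʳ zero    w {v} r a rewrite reach-zero⁻ r = reach-∷ 0 v a (reach-refl v)
  reach-∷ʳ (suc k) w {v} r a =
    let y , a′ , r′ = reach-∷⁻ k r in reach-∷ (suc k) y a′ (reach-∷ʳ k w r′ a)

  reach-sym : ∀ k {u v} → Reach k u v → Reach k v u
  reach-sym zero    r rewrite reach-zero⁻ r = reach-refl _
  reach-sym (suc k) {u} r =
    let y , a , r′ = reach-∷⁻ k r in reach-∷ʳ k y (reach-sym k r′) (adj-sym a)

  Path : Fin n → List (Fin n) → Fin n → Set
  Path x []       z = Adj x z
  Path x (y ∷ ys) z = Adj x y × Path y ys z

  path-∷ʳ : ∀ {x y z} ys → Path x ys y → Adj y z → Path x (ys ∷ʳ y) z
  path-∷ʳ []       p         a = p , a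
  path-∷ʳ (_ ∷ ys) (a′ , p) a = a′ , path-∷ʳ ys p a

  path-inner : ∀ {x z} ys → Path x ys z → (j : Fin (length ys)) →
               Adj (lookup (x ∷ ys) (inject₁ j)) (lookup (x ∷ ys) (suc j))
  path-inner (_ ∷ _)  (a , _) zero    = a
  path-inner (_ ∷ ys) (_ , p) (suc j) = path-inner ys p j

  path-last : ∀ {x z} ys → Path x ys z → Adj (lookup (x ∷ ys) (fromℕ (length ys))) z
  path-last []       a       = a
  path-last (_ ∷ ys) (_ , p) = path-last ys p

  closed-path⇒cycle : ∀ x p q r → Path x (p ∷ q ∷ r) x → Unique (x ∷ p ∷ q ∷ r) → Cycle G
  closed-path⇒cycle x p q r path uniq = record
    { len  = length r
    ; vert = lookup (x ∷ p ∷ q ∷ r)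
    ; inj  = lookup-injective uniq _ _
    ; edge = edge
    }
    where
    edge : ∀ i → Adj (lookup (x ∷ p ∷ q ∷ r) i) (lookup (x ∷ p ∷ q ∷ r) (next i))
    edge i with view i
    ... | ‵fromℕ  rewrite next-fromℕ (length (p ∷ q ∷ r)) = path-last (p ∷ q ∷ r) path
    ... | ‵inj₁ {i = j} _ rewrite next-inject₁ j = path-inner (p ∷ q ∷ r) path j

  reach-comm : ∀ k u v → reach G k u v ≡ reach G k v u
  reach-comm k u v = ⇔→≡ {z = true} (mk⇔ (reach-sym k) (reach-sym k))

  firstReach-comm : ∀ u v s b → firstReach G u v s b ≡ firstReach G v u s b
  firstReach-comm u v s zero = refl
  firstReach-comm u v s (suc b) rewrite reach-comm s u v | firstReach-comm u v (suc s) b = refl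

  dist-comm : ∀ u v → dist G u v ≡ dist G v u
  dist-comm u v = firstReach-comm u v 0 n

  firstReach-least : ∀ {u v m} s b → Least (λ k → reach G k u v) m → s ≤ m → m < s ℕ.+ b →
                     firstReach G u v s b ≡ just m
  firstReach-least s zero _ s≤m m<s+0 =
    contradiction (subst (_ <_) (ℕₚ.+-identityʳ s) m<s+0) (ℕₚ.≤⇒≯ s≤m)
  firstReach-least {u} {v} {m} s (suc b) (Pm , below) s≤m m<s+b with reach G s u v in Ps
  ... | true  = cong just (ℕₚ.≤-antisym s≤m (ℕₚ.≮⇒≥ λ s<m →
                  contradiction (trans (≡-sym Ps) (below s s<m)) λ ()))
  ... | false = firstReach-least (suc s) b (Pm , below) s<m (subst (m <_) (ℕₚ.+-suc s b) m<s+b)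
    where
    s<m : s < m
    s<m = ℕₚ.≤∧≢⇒< s≤m λ { refl → contradiction (trans (≡-sym Ps) Pm) λ () }

module Levels {n} (G : Graph n) (connected : Connected G) (t : Fin n) where
  open Walk G

  private
    shortest : ∀ u → ∃ (Least (λ k → reach G k u t))
    shortest u = let k , r = connected u t in least (λ k → reach G k u t) k r

  level : Fin n → ℕ
  level u = proj₁ (shortest u)

  level-least : ∀ u → Least (λ k → reach G k u t) (level u)
  level-least u = proj₂ (shortest u)

  level-reach : ∀ u → Reach (level u) u t
  level-reach u = proj₁ (level-least u)

  level-minimal : ∀ {u} k → Reach k u t → level u ≤ k
  level-minimal {u} k r =
    ℕₚ.≮⇒≥ λ k<l → contradiction (trans (≡-sym r) (proj₂ (level-least u) k k<l)) λ ()

  level-root : level t ≡ 0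
  level-root = ℕₚ.n≤0⇒n≡0 (level-minimal 0 (reach-refl t))

  level≡0⇒root : ∀ {u} → level u ≡ 0 → u ≡ t
  level≡0⇒root {u} e = reach-zero⁻ (subst (λ k → Reach k u t) e (level-reach u))

  level-adj : ∀ {u w} → Adj u w → level u ≤ suc (level w)
  level-adj {u} {w} a = level-minimal (suc (level w)) (reach-∷ (level w) w a (level-reach w))

  level-parent : ∀ {u j} → level u ≡ suc j → ∃ λ w → Adj u w × level w ≡ j
  level-parent {u} {j} e =
    let w , a , r = reach-∷⁻ j (subst (λ k → Reach k u t) e (level-reach u))
    in w , a , ℕₚ.≤-antisym (level-minimal j r) (s≤s⁻¹ (subst (_≤ suc (level w)) e (level-adj {u} a)))

  ancestor : ∀ k u → level u ≡ k → ∀ {j} → j ≤ k → ∃ λ w → level w ≡ j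
  ancestor zero    u e z≤n = u , e
  ancestor (suc k) u e j≤1+k with ℕₚ.m≤n⇒m<n∨m≡n j≤1+k
  ... | inj₂ refl  = u , e
  ... | inj₁ j<1+k = let w , _ , ew = level-parent e in ancestor k w ew (s≤s⁻¹ j<1+k)

  -- The ancestors of u have pairwise distinct levels 0, 1, …, level u.
  level<n : ∀ u → level u < n
  level<n u = Fin.injective⇒≤ at-injective
    where
    at : (i : Fin (suc (level u))) → ∃ λ w → level w ≡ toℕ i
    at i = ancestor (level u) u refl (s≤s⁻¹ (Fin.toℕ<n i))
    at-injective : ∀ {i j} → proj₁ (at i) ≡ proj₁ (at j) → i ≡ j
    at-injective {i} {j} e =
      Fin.toℕ-injective (trans (≡-sym (proj₂ (at i))) (trans (cong level e) (proj₂ (at j))))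

  dist-level : ∀ u → dist G u t ≡ just (level u)
  dist-level u = firstReach-least 0 n (level-least u) z≤n (level<n u)

module Tree {n} (G : Graph n) (connected : Connected G) (acyclic : Acyclic G) (t : Fin n) where
  open Walk G
  open Levels G connected t public

  level-<⇒≢ : ∀ {x y} → level x < level y → x ≢ y
  level-<⇒≢ lt refl = ℕₚ.<-irrefl refl lt

  Below : ℕ → List (Fin n) → Set
  Below k = All (λ y → level y < k)

  below⇒∉ : ∀ {x ys} → Below (level x) ys → All (x ≢_) ys
  below⇒∉ = All.map (λ ly → ≢-sym (level-<⇒≢ ly))

  LowPath : Fin n → Fin n → ℕ → Set
  LowPath a b k = ∃ λ m → ∃ λ ms → Path a (m ∷ ms) b × Below k (m ∷ ms) × Unique (m ∷ ms)

  -- Climb from a and b to their lowest common ancestor.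
  low-path : ∀ k {a b} → level a ≡ k → level b ≡ k → a ≢ b → LowPath a b k
  low-path zero la lb a≢b = contradiction (trans (level≡0⇒root la) (≡-sym (level≡0⇒root lb))) a≢b
  low-path (suc j) la lb a≢b with level-parent la | level-parent lb
  ... | pa , a~pa , lpa | pb , b~pb , lpb with pa ≟ pb
  ...   | yes refl = pa , [] , (a~pa , adj-sym b~pb) , (ℕₚ.≤-reflexive (cong suc lpa) ∷ []) , ([] ∷ [])
  ...   | no pa≢pb =
    let m , ms , path , below , uniq = low-path j lpa lpb pa≢pb in
    pa , (m ∷ ms) ∷ʳ pb ,
    (a~pa , path-∷ʳ (m ∷ ms) path (adj-sym b~pb)) ,
    (ℕₚ.≤-reflexive (cong suc lpa)
      ∷ Allₚ.++⁺ (All.map ℕₚ.m<n⇒m<1+n below) (ℕₚ.≤-reflexive (cong suc lpb) ∷ [])) ,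
    (Allₚ.++⁺ (below⇒∉ (subst (λ k → Below k (m ∷ ms)) (≡-sym lpa) below)) (pa≢pb ∷ [])
      ∷ AllPairsₚ.++⁺ uniq ([] ∷ [])
          (All.map (λ ly → level-<⇒≢ (subst (_ <_) (≡-sym lpb) ly) ∷ []) below))

  adj⇒level≢ : ∀ {a b} → Adj a b → level a ≢ level b
  adj⇒level≢ {a} {b} a~b la≡lb =
    let m , ms , path , below , uniq = low-path (level a) refl (≡-sym la≡lb) (adj-irrefl a~b) in
    acyclic (closed-path⇒cycle b a m ms (adj-sym a~b , path)
      ((≢-sym (adj-irrefl a~b) ∷ below⇒∉ (subst (λ k → Below k (m ∷ ms)) la≡lb below))
        ∷ below⇒∉ below ∷ uniq))

  parent-unique : ∀ {u a b} → Adj u a → Adj u b →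
                  level u ≡ suc (level a) → level u ≡ suc (level b) → a ≡ b
  parent-unique {u} {a} {b} u~a u~b lu≡1+la lu≡1+lb with a ≟ b
  ... | yes a≡b = a≡b
  ... | no a≢b  =
    let m , ms , path , below , uniq = low-path (level a) refl lb≡la a≢b in
    contradiction (closed-path⇒cycle b u a (m ∷ ms) (adj-sym u~b , u~a , path)
      ((level-<⇒≢ lb<lu ∷ ≢-sym a≢b ∷ below⇒∉ (subst (λ k → Below k (m ∷ ms)) (≡-sym lb≡la) below))
        ∷ (≢-sym (level-<⇒≢ la<lu) ∷ below⇒∉ (All.map (λ ly → ℕₚ.<-trans ly la<lu) below))
        ∷ below⇒∉ below ∷ uniq)) acyclic
    where
    lb≡la : level b ≡ level a
    lb≡la = ℕₚ.suc-injective (trans (≡-sym lu≡1+lb) lu≡1+la)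
    la<lu : level a < level u
    la<lu = ℕₚ.≤-reflexive (≡-sym lu≡1+la)
    lb<lu : level b < level u
    lb<lu = ℕₚ.≤-reflexive (≡-sym lu≡1+lb)

  adj⇒level-step : ∀ {u w} → Adj u w → level u ≡ suc (level w) ⊎ level w ≡ suc (level u)
  adj⇒level-step {u} {w} u~w with ℕₚ.<-cmp (level u) (level w)
  ... | tri< lu<lw _ _ = inj₂ (ℕₚ.≤-antisym (level-adj (adj-sym u~w)) lu<lw)
  ... | tri≈ _ lu≡lw _ = contradiction lu≡lw (adj⇒level≢ u~w)
  ... | tri> _ _ lw<lu = inj₁ (ℕₚ.≤-antisym (level-adj u~w) lw<lu)

  parent : Fin n → Fin n → Bool
  parent u w = adj G u w ∧ ⌊ level u ℕ.≟ suc (level w) ⌋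

  parent⁻ : ∀ {u w} → parent u w ≡ true → Adj u w × level u ≡ suc (level w)
  parent⁻ {u} {w} e =
    ∧-conicalˡ _ _ e , ⌊⌋-true⁻ (level u ℕ.≟ suc (level w)) (∧-conicalʳ _ _ e)

  adj-split : ∀ u w → b2n (adj G u w) ≡ b2n (parent u w) ℕ.+ b2n (parent w u)
  adj-split u w =
    trans (b2n-split (adj G u w) _ _ λ u~w → b2n-step-apart (adj⇒level-step u~w))
          (cong (λ x → b2n (parent u w) ℕ.+ b2n (x ∧ ⌊ level w ℕ.≟ suc (level u) ⌋)) (sym G u w))

  root-parentless : ∀ w → parent t w ≡ false
  root-parentless w = ¬-not λ e → ℕₚ.0≢1+n (trans (≡-sym level-root) (proj₂ (parent⁻ e)))

  parent-exists : ∀ {u} → u ≢ t → ∃ λ w → parent u w ≡ true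
  parent-exists {u} u≢t with level u in lu
  ... | zero  = contradiction (level≡0⇒root lu) u≢t
  ... | suc j = let w , u~w , lw = level-parent lu
                in w , cong₂ _∧_ u~w (⌊⌋-true⁺ (suc j ℕ.≟ suc (level w)) (cong suc (≡-sym lw)))

  parent-count : ∀ u → sumℕ (b2n ∘ parent u) ℕ.+ b2n ⌊ u ≟ t ⌋ ≡ 1
  parent-count u with u ≟ t
  ... | yes refl = cong (ℕ._+ 1) (sumℕ-b2n-none (parent t) root-parentless)
  ... | no u≢t   = let w , pw = parent-exists u≢t in
    trans (ℕₚ.+-identityʳ _) (sumℕ-b2n-unique (parent u) w pw λ w′ pw′ →
      let u~w , lu = parent⁻ pw ; u~w′ , lu′ = parent⁻ pw′ in parent-unique u~w′ u~w lu′ lu)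

module WeightedDegree {c ℓ} (R : CommutativeSemiring c ℓ) where
  open CommutativeSemiring R hiding (zero) renaming (refl to ≈-refl; sym to ≈-sym; trans to ≈-trans)
  open import Algebra.Properties.Semiring.Sum semiring
    using (sum; sum-cong-≋; sum-replicate-zero; ∑-distrib-+; ∑-comm; *-distribˡ-sum)
  open import Algebra.Properties.Semiring.Mult semiring using (×-homo-+) renaming (_×_ to _·_)
  open import Relation.Binary.Reasoning.Setoid setoid

  ι : ℕ → Carrier
  ι k = k · 1#

  ι-+ : ∀ a b → ι (a ℕ.+ b) ≈ ι a + ι b
  ι-+ = ×-homo-+ 1#

  ι-sumℕ : ∀ {n} (f : Fin n → ℕ) → ι (sumℕ f) ≈ sum (ι ∘ f)
  ι-sumℕ {zero}  f = ≈-refl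
  ι-sumℕ {suc n} f = ≈-trans (ι-+ (f zero) _) (+-congˡ (ι-sumℕ (f ∘ suc)))

  sum-*-ι0 : ∀ {n} (f : Fin n → Carrier) → sum (λ u → f u * ι 0) ≈ 0#
  sum-*-ι0 {n} f = ≈-trans (sum-cong-≋ (λ u → zeroʳ (f u))) (sum-replicate-zero n)

  sum-select : ∀ {n} (f : Fin n → Carrier) i → sum (λ u → f u * ι (b2n ⌊ u ≟ i ⌋)) ≈ f i
  sum-select {suc n} f zero = begin
    f zero * ι 1 + sum (λ u → f (suc u) * ι 0)
      ≈⟨ +-cong (*-congˡ (+-identityʳ 1#)) (sum-*-ι0 (f ∘ suc)) ⟩
    f zero * 1# + 0#
      ≈⟨ ≈-trans (+-identityʳ _) (*-identityʳ _) ⟩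
    f zero ∎
  sum-select {suc n} f (suc i) = begin
    f zero * ι 0 + sum (λ u → f (suc u) * ι (b2n ⌊ suc u ≟ suc i ⌋))
      ≈⟨ +-cong (zeroʳ _) (≈-trans (sum-cong-≋ shift) (sum-select (f ∘ suc) i)) ⟩
    0# + f (suc i)
      ≈⟨ +-identityˡ _ ⟩
    f (suc i) ∎
    where
    shift : ∀ u → f (suc u) * ι (b2n ⌊ suc u ≟ suc i ⌋) ≈ f (suc u) * ι (b2n ⌊ u ≟ i ⌋)
    shift u = reflexive (cong (λ b → f (suc u) * ι (b2n b)) (⌊suc≟suc⌋ u i))

  module _ {n} (E parent : Fin n → Fin n → Bool) (root : Fin n)
           (edge-split : ∀ u w → b2n (E u w) ≡ b2n (parent u w) ℕ.+ b2n (parent w u))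
           (parent-count : ∀ u → sumℕ (b2n ∘ parent u) ℕ.+ b2n ⌊ u ≟ root ⌋ ≡ 1)
           (a : Carrier) (h : Fin n → Carrier)
           (h-child : ∀ w u → parent w u ≡ true → h u ≈ a * h w) where

    𝟙 : Bool → Carrier
    𝟙 b = ι (b2n b)

    toParent toChild : Fin n → Fin n → Carrier
    toParent u w = h u * 𝟙 (parent u w)
    toChild  u w = h u * 𝟙 (parent w u)

    atRoot : Fin n → Carrier
    atRoot u = h u * 𝟙 ⌊ u ≟ root ⌋

    Out : Carrier
    Out = sum (λ u → sum (toParent u))

    deg : Fin n → ℕ
    deg u = sumℕ (b2n ∘ E u)

    out-sum : Out + h root ≈ sum h
    out-sum = begin
      Out + h root                                    ≈⟨ +-congˡ (≈-sym (sum-select h root)) ⟩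
      Out + sum atRoot                                ≈⟨ ≈-sym (∑-distrib-+ (sum ∘ toParent) atRoot) ⟩
      sum (λ u → sum (toParent u) + atRoot u)         ≈⟨ sum-cong-≋ per-vertex ⟩
      sum h                                           ∎
      where
      per-vertex : ∀ u → sum (toParent u) + atRoot u ≈ h u
      per-vertex u = begin
        sum (toParent u) + atRoot u
          ≈⟨ +-congʳ (≈-trans (≈-sym (*-distribˡ-sum (h u) (𝟙 ∘ parent u)))
                              (*-congˡ (≈-sym (ι-sumℕ (b2n ∘ parent u))))) ⟩
        h u * ι (sumℕ (b2n ∘ parent u)) + atRoot u
          ≈⟨ ≈-sym (distribˡ (h u) _ _) ⟩
        h u * (ι (sumℕ (b2n ∘ parent u)) + 𝟙 ⌊ u ≟ root ⌋)
          ≈⟨ *-congˡ (≈-trans (≈-sym (ι-+ (sumℕ (b2n ∘ parent u)) (b2n ⌊ u ≟ root ⌋)))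
                              (reflexive (cong ι (parent-count u)))) ⟩
        h u * ι 1
          ≈⟨ ≈-trans (*-congˡ (+-identityʳ 1#)) (*-identityʳ (h u)) ⟩
        h u ∎

    in-sum : sum (λ u → sum (toChild u)) ≈ a * Out
    in-sum = begin
      sum (λ u → sum (toChild u))
        ≈⟨ ∑-comm toChild ⟩
      sum (λ w → sum (λ u → toChild u w))
        ≈⟨ sum-cong-≋ (λ w → sum-cong-≋ (child-term w)) ⟩
      sum (λ w → sum (λ u → a * toParent w u))
        ≈⟨ sum-cong-≋ (λ w → ≈-sym (*-distribˡ-sum a (toParent w))) ⟩
      sum (λ w → a * sum (toParent w))
        ≈⟨ ≈-sym (*-distribˡ-sum a (sum ∘ toParent)) ⟩
      a * Out ∎
      where
      child-term : ∀ w u → toChild u w ≈ a * toParent w u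
      child-term w u with parent w u in pwu
      ... | false = ≈-trans (zeroʳ (h u)) (≈-sym (≈-trans (*-congˡ (zeroʳ (h w))) (zeroʳ a)))
      ... | true  = ≈-trans (*-congʳ (h-child w u pwu)) (*-assoc a (h w) (ι 1))

    weighted-degree-sum : sum (λ u → h u * ι (deg u)) + (1# + a) * h root ≈ (1# + a) * sum h
    weighted-degree-sum = begin
      sum (λ u → h u * ι (deg u)) + (1# + a) * h root
        ≈⟨ +-congʳ (≈-trans (sum-cong-≋ split) (∑-distrib-+ (sum ∘ toParent) (sum ∘ toChild))) ⟩
      (Out + sum (λ u → sum (toChild u))) + (1# + a) * h root
        ≈⟨ +-congʳ (+-cong (≈-sym (*-identityˡ Out)) in-sum) ⟩
      (1# * Out + a * Out) + (1# + a) * h root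
        ≈⟨ +-congʳ (≈-sym (distribʳ Out 1# a)) ⟩
      (1# + a) * Out + (1# + a) * h root
        ≈⟨ ≈-sym (distribˡ (1# + a) Out (h root)) ⟩
      (1# + a) * (Out + h root)
        ≈⟨ *-congˡ out-sum ⟩
      (1# + a) * sum h ∎
      where
      split : ∀ u → h u * ι (deg u) ≈ sum (toParent u) + sum (toChild u)
      split u = begin
        h u * ι (deg u)                     ≈⟨ *-congˡ (ι-sumℕ (b2n ∘ E u)) ⟩
        h u * sum (λ w → 𝟙 (E u w))         ≈⟨ *-distribˡ-sum (h u) (𝟙 ∘ E u) ⟩
        sum (λ w → h u * 𝟙 (E u w))         ≈⟨ sum-cong-≋ edge-term ⟩
        sum (λ w → toParent u w + toChild u w) ≈⟨ ∑-distrib-+ (toParent u) (toChild u) ⟩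
        sum (toParent u) + sum (toChild u)  ∎
        where
        edge-term : ∀ w → h u * 𝟙 (E u w) ≈ toParent u w + toChild u w
        edge-term w = ≈-trans (*-congˡ (≈-trans (reflexive (cong ι (edge-split u w)))
                                                    (ι-+ (b2n (parent u w)) (b2n (parent w u)))))
                              (distribˡ (h u) _ _)

    spare-degree-sum : (∀ u → deg u ≤ 3) →
                 sum (λ u → h u * ι (3 ℕ.∸ deg u)) + (1# + a) * sum h ≈ ι 3 * sum h + (1# + a) * h root
    spare-degree-sum subcubic = begin
      sum spare + (1# + a) * sum h               ≈⟨ +-congˡ (≈-sym weighted-degree-sum) ⟩
      sum spare + (sum used + (1# + a) * h root) ≈⟨ ≈-sym (+-assoc _ _ _) ⟩
      (sum spare + sum used) + (1# + a) * h root ≈⟨ +-congʳ (≈-sym (∑-distrib-+ spare used)) ⟩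
      sum (λ u → spare u + used u) + (1# + a) * h root ≈⟨ +-congʳ (sum-cong-≋ per-vertex) ⟩
      sum (λ u → ι 3 * h u) + (1# + a) * h root   ≈⟨ +-congʳ (≈-sym (*-distribˡ-sum (ι 3) h)) ⟩
      ι 3 * sum h + (1# + a) * h root             ∎
      where
      spare used : Fin n → Carrier
      spare u = h u * ι (3 ℕ.∸ deg u)
      used u = h u * ι (deg u)
      per-vertex : ∀ u → spare u + used u ≈ ι 3 * h u
      per-vertex u = begin
        spare u + used u                ≈⟨ ≈-sym (distribˡ (h u) _ _) ⟩
        h u * (ι (3 ℕ.∸ deg u) + ι (deg u)) ≈⟨ *-congˡ (≈-sym (ι-+ (3 ℕ.∸ deg u) (deg u))) ⟩
        h u * ι (3 ℕ.∸ deg u ℕ.+ deg u)    ≈⟨ *-congˡ (reflexive (cong ι (ℕₚ.m∸n+n≡m (subcubic u)))) ⟩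
        h u * ι 3                          ≈⟨ *-comm (h u) (ι 3) ⟩
        ι 3 * h u                          ∎

+-same-denominator : ∀ a b d → (+ a) / suc d ℚ.+ (+ b) / suc d ≡ (+ (a ℕ.+ b)) / suc d
+-same-denominator a b d = ℚₚ.toℚᵘ-injective (begin
  ℚ.toℚᵘ ((+ a) / suc d ℚ.+ (+ b) / suc d)
    ≈⟨ ℚₚ.toℚᵘ-homo-+ ((+ a) / suc d) ((+ b) / suc d) ⟩
  ℚ.toℚᵘ ((+ a) / suc d) ℚᵘ.+ ℚ.toℚᵘ ((+ b) / suc d)
    ≈⟨ ℚᵘₚ.+-cong (ℚₚ.toℚᵘ-fromℚᵘ (mkℚᵘ (+ a) d)) (ℚₚ.toℚᵘ-fromℚᵘ (mkℚᵘ (+ b) d)) ⟩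
  mkℚᵘ (+ a) d ℚᵘ.+ mkℚᵘ (+ b) d
    ≈⟨ *≡* (trans (cross (+ a) (+ b) (+ suc d))
                  (cong (ℤ._* (+ suc d ℤ.* + suc d)) (≡-sym (ℤₚ.pos-+ a b)))) ⟩
  mkℚᵘ (+ (a ℕ.+ b)) d
    ≈⟨ ℚᵘₚ.≃-sym (ℚₚ.toℚᵘ-fromℚᵘ (mkℚᵘ (+ (a ℕ.+ b)) d)) ⟩
  ℚ.toℚᵘ ((+ (a ℕ.+ b)) / suc d) ∎)
  where
  open import Relation.Binary.Reasoning.Setoid ℚᵘₚ.≃-setoid
  cross : ∀ (x y e : ℤ) → (x ℤ.* e ℤ.+ y ℤ.* e) ℤ.* e ≡ (x ℤ.+ y) ℤ.* (e ℤ.* e)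
  cross = solve-∀

ℚ-semiring : CommutativeSemiring _ _
ℚ-semiring = CommutativeRing.commutativeSemiring ℚₚ.+-*-commutativeRing

open WeightedDegree ℚ-semiring using (ι; ι-+; spare-degree-sum)
open import Algebra.Properties.Semiring.Sum (CommutativeSemiring.semiring ℚ-semiring)
  using (sum; sum-cong-≋; sum-replicate; ∑-comm; *-distribˡ-sum; *-distribʳ-sum)

sumℚ≡sum : ∀ {n} (f : Fin n → ℚ) → sumℚ f ≡ sum f
sumℚ≡sum {zero}  f = refl
sumℚ≡sum {suc n} f = cong (f zero ℚ.+_) (sumℚ≡sum (f ∘ suc))

sum-mono-≤ : ∀ {n} {f g : Fin n → ℚ} → (∀ i → f i ℚ.≤ g i) → sum f ℚ.≤ sum g
sum-mono-≤ {zero}  _   = ℚₚ.≤-refl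
sum-mono-≤ {suc n} f≤g = ℚₚ.+-mono-≤ (f≤g zero) (sum-mono-≤ (f≤g ∘ suc))

+-cancel-comm : ∀ {p q r : ℚ} → p ℚ.+ q ≡ q ℚ.+ r → p ≡ r
+-cancel-comm {p} {q} {r} e = ∙-cancelʳ q p r (trans e (ℚₚ.+-comm q r))

ι-nonneg : ∀ k → 0ℚ ℚ.≤ ι k
ι-nonneg zero    = ℚₚ.≤-refl
ι-nonneg (suc k) = ℚₚ.+-mono-≤ {0ℚ} {1ℚ} {0ℚ} (ℚₚ.nonNegative⁻¹ 1ℚ) (ι-nonneg k)

ι-*-/ : ∀ k d → ι k ℚ.* ((+ 1) / suc d) ≡ (+ k) / suc d
ι-*-/ zero    d = trans (ℚₚ.*-zeroˡ ((+ 1) / suc d)) (≡-sym (ℚₚ.0/n≡0 (suc d)))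
ι-*-/ (suc k) d = begin
  (1ℚ ℚ.+ ι k) ℚ.* c             ≡⟨ ℚₚ.*-distribʳ-+ c 1ℚ (ι k) ⟩
  1ℚ ℚ.* c ℚ.+ ι k ℚ.* c         ≡⟨ cong₂ ℚ._+_ (ℚₚ.*-identityˡ c) (ι-*-/ k d) ⟩
  (+ 1) / suc d ℚ.+ (+ k) / suc d ≡⟨ +-same-denominator 1 k d ⟩
  (+ suc k) / suc d               ∎
  where
  open ≡-Reasoning
  c = (+ 1) / suc d

weak-duality : ∀ {n} (W : Fin n → Fin n → ℚ) (y z : Fin n → ℚ) →
               (∀ v → 0ℚ ℚ.≤ y v) → (∀ u → sum (λ v → W u v ℚ.* y v) ≡ 1ℚ) →
               (∀ v → 1ℚ ℚ.≤ sum (λ u → W u v ℚ.* z u)) → sum y ℚ.≤ sum z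
weak-duality W y z y≥0 Wy≡1 Wᵀz≥1 = begin
  sum y
    ≤⟨ sum-mono-≤ y≤y·Wᵀz ⟩
  sum (λ v → y v ℚ.* sum (λ u → W u v ℚ.* z u))
    ≡⟨ sum-cong-≋ (λ v → *-distribˡ-sum (y v) (λ u → W u v ℚ.* z u)) ⟩
  sum (λ v → sum (λ u → y v ℚ.* (W u v ℚ.* z u)))
    ≡⟨ ∑-comm (λ v u → y v ℚ.* (W u v ℚ.* z u)) ⟩
  sum (λ u → sum (λ v → y v ℚ.* (W u v ℚ.* z u)))
    ≡⟨ sum-cong-≋ (λ u → sum-cong-≋ (λ v → swap (y v) (W u v) (z u))) ⟩
  sum (λ u → sum (λ v → z u ℚ.* (W u v ℚ.* y v)))
    ≡⟨ sum-cong-≋ (λ u → ≡-sym (*-distribˡ-sum (z u) (λ v → W u v ℚ.* y v))) ⟩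
  sum (λ u → z u ℚ.* sum (λ v → W u v ℚ.* y v))
    ≡⟨ sum-cong-≋ (λ u → trans (cong (z u ℚ.*_) (Wy≡1 u)) (ℚₚ.*-identityʳ (z u))) ⟩
  sum z ∎
  where
  open ℚₚ.≤-Reasoning
  y≤y·Wᵀz : ∀ v → y v ℚ.≤ y v ℚ.* sum (λ u → W u v ℚ.* z u)
  y≤y·Wᵀz v = ℚₚ.≤-trans (ℚₚ.≤-reflexive (≡-sym (ℚₚ.*-identityʳ (y v))))
                          (ℚₚ.*-monoˡ-≤-nonNeg (y v) {{ℚ.nonNegative (y≥0 v)}} (Wᵀz≥1 v))
  swap : ∀ a w b → a ℚ.* (w ℚ.* b) ≡ b ℚ.* (w ℚ.* a)
  swap = solve 3 (λ a w b → a :* (w :* b) := b :* (w :* a)) refl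
    where open +-*-Solver

module SubcubicTree {n} (T : Graph n) (connected : Connected T) (acyclic : Acyclic T)
                    (subcubic : Subcubic T) where

  W : Fin n → Fin n → ℚ
  W u v = weight (dist T u v)

  x : Fin n → ℚ
  x u = ι (3 ℕ.∸ degree T u) ℚ.* ((+ 1) / 6)

  x-nonneg : ∀ u → 0ℚ ℚ.≤ x u
  x-nonneg u = ℚₚ.*-monoʳ-≤-nonNeg ((+ 1) / 6) (ι-nonneg (3 ℕ.∸ degree T u))

  x-covers-exactly : ∀ t → sum (λ u → W u t ℚ.* x u) ≡ 1ℚ
  x-covers-exactly t = begin
    sum (λ u → W u t ℚ.* x u)               ≡⟨ sum-cong-≋ term ⟩
    sum (λ u → c ℚ.* spare u)               ≡⟨ ≡-sym (*-distribˡ-sum c spare) ⟩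
    c ℚ.* sum spare                         ≡⟨ cong (c ℚ.*_) spare-sum ⟩
    c ℚ.* (ι 3 ℚ.* half^ (level t))         ≡⟨ cong (λ k → c ℚ.* (ι 3 ℚ.* half^ k)) level-root ⟩
    1ℚ                                      ∎
    where
    open Tree T connected acyclic t
    open ≡-Reasoning
    c = (+ 2) / 1 ℚ.* ((+ 1) / 6)
    spare : Fin n → ℚ
    spare u = half^ (level u) ℚ.* ι (3 ℕ.∸ degree T u)
    term : ∀ u → W u t ℚ.* x u ≡ c ℚ.* spare u
    term u rewrite dist-level u = regroup (half^ (level u)) (ι (3 ℕ.∸ degree T u))
      where
      open +-*-Solver
      regroup : ∀ p q → ((+ 2) / 1 ℚ.* p) ℚ.* (q ℚ.* ((+ 1) / 6)) ≡ c ℚ.* (p ℚ.* q)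
      regroup = solve 2 (λ p q → (con ((+ 2) / 1) :* p) :* (q :* con ((+ 1) / 6))
                                 := (con ((+ 2) / 1) :* con ((+ 1) / 6)) :* (p :* q)) refl
    halving : ∀ w u → parent w u ≡ true → half^ (level u) ≡ ι 2 ℚ.* half^ (level w)
    halving w u p rewrite proj₂ (parent⁻ p) =
      trans (≡-sym (ℚₚ.*-identityˡ (half^ (level u)))) (ℚₚ.*-assoc (ι 2) ½ (half^ (level u)))
    spare-sum : sum spare ≡ ι 3 ℚ.* half^ (level t)
    spare-sum = +-cancel-comm (spare-degree-sum (adj T) parent t adj-split parent-count
                                                (ι 2) (half^ ∘ level) halving subcubic)

  x-feasible : Feasible T x
  x-feasible = x-nonneg , λ v →
    ℚₚ.≤-reflexive (≡-sym (trans (sumℚ≡sum (λ u → W u v ℚ.* x u)) (x-covers-exactly v)))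

  x-total : Fin n → sumℚ x ≡ (+ (n ℕ.+ 2)) / 6
  x-total r = begin
    sumℚ x                                     ≡⟨ sumℚ≡sum x ⟩
    sum x                                      ≡⟨ ≡-sym (*-distribʳ-sum ((+ 1) / 6) (ι ∘ spare)) ⟩
    sum (ι ∘ spare) ℚ.* ((+ 1) / 6)            ≡⟨ cong (ℚ._* ((+ 1) / 6)) spare-sum ⟩
    ι (n ℕ.+ 2) ℚ.* ((+ 1) / 6)                ≡⟨ ι-*-/ (n ℕ.+ 2) 5 ⟩
    (+ (n ℕ.+ 2)) / 6                          ∎
    where
    open Tree T connected acyclic r
    open ≡-Reasoning
    spare : Fin n → ℕ
    spare u = 3 ℕ.∸ degree T u
    N : ℚ
    N = sum {n} (λ _ → 1ℚ)
    rearrange : ∀ p → ι 3 ℚ.* p ℚ.+ (1ℚ ℚ.+ 1ℚ) ℚ.* 1ℚ ≡ (1ℚ ℚ.+ 1ℚ) ℚ.* p ℚ.+ (p ℚ.+ ι 2)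
    rearrange = solve 1 (λ p → con (ι 3) :* p :+ con (1ℚ ℚ.+ 1ℚ) :* con 1ℚ
                               := con (1ℚ ℚ.+ 1ℚ) :* p :+ (p :+ con (ι 2))) refl
      where open +-*-Solver
    balance : sum (ι ∘ spare) ℚ.+ (1ℚ ℚ.+ 1ℚ) ℚ.* N ≡ (1ℚ ℚ.+ 1ℚ) ℚ.* N ℚ.+ (N ℚ.+ ι 2)
    balance = begin
      sum (ι ∘ spare) ℚ.+ (1ℚ ℚ.+ 1ℚ) ℚ.* N
        ≡⟨ cong (ℚ._+ (1ℚ ℚ.+ 1ℚ) ℚ.* N) (sum-cong-≋ λ u → ≡-sym (ℚₚ.*-identityˡ (ι (spare u)))) ⟩
      sum (λ u → 1ℚ ℚ.* ι (spare u)) ℚ.+ (1ℚ ℚ.+ 1ℚ) ℚ.* N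
        ≡⟨ spare-degree-sum (adj T) parent r adj-split parent-count
                            1ℚ (λ _ → 1ℚ) (λ _ _ _ → refl) subcubic ⟩
      ι 3 ℚ.* N ℚ.+ (1ℚ ℚ.+ 1ℚ) ℚ.* 1ℚ
        ≡⟨ rearrange N ⟩
      (1ℚ ℚ.+ 1ℚ) ℚ.* N ℚ.+ (N ℚ.+ ι 2) ∎
    spare-sum : sum (ι ∘ spare) ≡ ι (n ℕ.+ 2)
    spare-sum = begin
      sum (ι ∘ spare)   ≡⟨ +-cancel-comm balance ⟩
      N ℚ.+ ι 2         ≡⟨ cong (ℚ._+ ι 2) (sum-replicate n) ⟩
      ι n ℚ.+ ι 2       ≡⟨ ≡-sym (ι-+ n 2) ⟩
      ι (n ℕ.+ 2)       ∎

  x-optimal : ∀ z → Feasible T z → sumℚ x ℚ.≤ sumℚ z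
  x-optimal z (_ , z-covers) =
    subst₂ ℚ._≤_ (≡-sym (sumℚ≡sum x)) (≡-sym (sumℚ≡sum z))
      (weak-duality W x z x-nonneg rows
        λ v → subst (1ℚ ℚ.≤_) (sumℚ≡sum (λ u → W u v ℚ.* z u)) (z-covers v))
    where
    open Walk T using (dist-comm)
    rows : ∀ u → sum (λ v → W u v ℚ.* x v) ≡ 1ℚ
    rows u = trans (sum-cong-≋ λ v → cong (λ d → weight d ℚ.* x v) (dist-comm u v)) (x-covers-exactly u)

theorem1 : (n : ℕ) (T : Graph n) → IsTree T → Subcubic T →
    LPOptimum T ((+ (n Data.Nat.+ 2)) / 6)
theorem1 zero    T (() , _) _
theorem1 (suc m) T (_ , connected , acyclic) subcubic =
  (x , x-feasible , x-total zero) ,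
  λ z z-feasible → subst (ℚ._≤ sumℚ z) (x-total zero) (x-optimal z z-feasible)
  where open SubcubicTree T connected acyclic subcubic
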